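{- The equation $x+y=z$ with $x,y,z\in\mathcal{B}_{2,1}$ and $x\le y$ has exactly four solutions: $$x=2-\sqrt{3}=[3,\overline{1,2}],\ y=\tfrac{\sqrt{3}-1}{2}=[\overline{2,1}],\ z=\tfrac{3-\sqrt{3}}{2}=[1,1,1,\overline{2,1}];$$ $$x=y=\tfrac{\sqrt{3}-1}{2}=[\overline{2,1}],\ z=\sqrt{3}-1=[\overline{1,2}];$$ $$x=y=\tfrac{2-\sqrt{2}}{2}=[3,\overline{2}],\ z=2-\sqrt{2}=[1,1,\overline{2}];$$ $$x=\tfrac{2-\sqrt{2}}{2}=[3,\overline{2}],\ y=\sqrt{2}-1=[\overline{2}],\ z=\tfrac{\sqrt{2}}{2}=[1,\overline{2}].$$
   Context: Every irrational $x\in(0,1)$ has a simple continued fraction expansion $x=[a_1,a_2,\dots]=\cfrac{1}{a_1+\cfrac{1}{a_2+\cdots}}$ with positive integers $a_k=a_k(x)$; an overline denotes a periodically repeated block. $\mathcal{B}_{2,1}$ denotes the set of irrational $x\in(0,1)$ with $a_1(x)\le 3$ and $a_k(x)\le 2$ for all $k\ge2$. -}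

module Defs where

open import Data.Nat using (ℕ; zero; suc; _+_; _*_; _≤_; _<_)
open import Data.Product using (_×_; _,_; proj₁; proj₂)
open import Data.Sum using (_⊎_)
open import Relation.Binary.PropositionalEquality using (_≡_)

-- An irrational x ∈ (0,1) is represented by its (infinite) sequence of
-- partial quotients: a : ℕ → ℕ with a 0 = a_1, a 1 = a_2, ...
CF : Set
CF = ℕ → ℕ

B21 : CF → Set
B21 a = (∀ n → 1 ≤ a n) × (a 0 ≤ 3) × (∀ n → a (suc n) ≤ 2)

-- Convergents p_n / q_n of [0; a_1, a_2, ...]:
-- state (p_{n-1}, q_{n-1}, p_n, q_n); p_{-1}=1, q_{-1}=0, p_0=0, q_0=1.
State : Set
State = ℕ × ℕ × ℕ × ℕ

step : ℕ → State → State
step d (p' , q' , p , q) = (p , q , d * p + p' , d * q + q')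

conv : CF → ℕ → State
conv a zero = (1 , 0 , 0 , 1)
conv a (suc n) = step (a n) (conv a n)

cvg : CF → ℕ → ℕ × ℕ
cvg a n = proj₁ (proj₂ (proj₂ (conv a n))) , proj₂ (proj₂ (proj₂ (conv a n)))

-- lower bounds c_0 < c_2 < c_4 < ... < x and upper bounds x < ... < c_3 < c_1
lo hi : CF → ℕ → ℕ × ℕ
lo a n = cvg a (2 * n)
hi a n = cvg a (suc (2 * n))

-- comparisons of nonnegative fractions with positive denominators,
-- by cross-multiplication in ℕ
-- a/b + c/d < e/f
sum<frac : ℕ × ℕ → ℕ × ℕ → ℕ × ℕ → Set
sum<frac (a , b) (c , d) (e , f) = (a * d + c * b) * f < e * (b * d)

frac<sum : ℕ × ℕ → ℕ × ℕ → ℕ × ℕ → Set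
frac<sum (e , f) (a , b) (c , d) = e * (b * d) < (a * d + c * b) * f

frac< : ℕ × ℕ → ℕ × ℕ → Set
frac< (a , b) (c , d) = a * d < c * b

-- value(x) + value(y) = value(z), where value is the limit of convergents
-- (the unique point of the nested intervals [lo n , hi n]).
SumEq : CF → CF → CF → Set
SumEq x y z = ∀ n → sum<frac (lo x n) (lo y n) (hi z n)
                  × frac<sum (lo z n) (hi x n) (hi y n)

Leq : CF → CF → Set
Leq x y = ∀ n → frac< (lo x n) (hi y n)

_≗cf_ : CF → CF → Set
a ≗cf b = ∀ n → a n ≡ b n

alt : ℕ → ℕ → ℕ → ℕ
alt u v zero = u
alt u v (suc n) = alt v u n

-- [3, 1,2,1,2,...] = 2 - √3
s3̅12 : CF
s3̅12 zero = 3
s3̅12 (suc n) = alt 1 2 n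

-- [2,1,2,1,...] = (√3 - 1)/2
s̅21 : CF
s̅21 = alt 2 1

-- [1,1,1, 2,1,2,1,...] = (3 - √3)/2
s111̅21 : CF
s111̅21 zero = 1
s111̅21 (suc zero) = 1
s111̅21 (suc (suc zero)) = 1
s111̅21 (suc (suc (suc n))) = alt 2 1 n

-- [1,2,1,2,...] = √3 - 1
s̅12 : CF
s̅12 = alt 1 2

-- [3, 2,2,...] = (2 - √2)/2
s3̅2 : CF
s3̅2 zero = 3
s3̅2 (suc n) = 2

-- [2,2,...] = √2 - 1
s̅2 : CF
s̅2 n = 2

-- [1,1, 2,2,...] = 2 - √2
s11̅2 : CF
s11̅2 zero = 1
s11̅2 (suc zero) = 1
s11̅2 (suc (suc n)) = 2

-- [1, 2,2,...] = √2/2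
s1̅2 : CF
s1̅2 zero = 1
s1̅2 (suc n) = 2

{-# OPTIONS --safe #-}
-- Each convergent box of (x, y, z) brackets the equation x + y = z: the trilinear form
-- sumForm, which is q_u q_v q_w (u + v − w) on fractions u = p_u/q_u, …, is negative at
-- (lo x, lo y, hi z) and positive at (hi x, hi y, lo z) at every level.  Reading off two
-- digits of x, y, z pulls the form back along the corresponding digit matrices, so the
-- tails are bracketed by the pulled-back form.  A finite search over digits leaves six
-- leading blocks of digits, two of which contradict x ≤ y one level down.  For each of
-- the other four, the pulled-back form G₁ spans, together with a second form G₂, a cone
-- that the period of the claimed solution maps into itself up to a positive factor; a
-- second search shows that every form of this cone forces that period again, so all
-- digits are determined.  Conversely, G₁ and G₂ have the right strict signs at level
-- zero, and the invariance of the cone carries them to every level.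
module Submission where

open import Defs
open import Data.Product using (_×_)
open import Data.Sum using (_⊎_)

open import Data.Nat as ℕ using (ℕ; zero; suc; z≤n; s≤s)
import Data.Nat.Properties as ℕₚ
open import Data.Integer as ℤ using (ℤ; +_; -[1+_]; 0ℤ)
import Data.Integer.Properties as ℤₚ
open import Data.Product using (_,_; proj₁; proj₂)
open import Data.Product.Properties using (≡-dec; ,-injective)
open import Data.Sum using (inj₁; inj₂)
open import Data.Empty using (⊥; ⊥-elim)
open import Data.List using (List; []; _∷_; cartesianProduct)
open import Data.List.Relation.Unary.All as All using (All; all?)
open import Data.List.Relation.Unary.Any using (here; there)
open import Data.List.Relation.Unary.Any.Properties using (¬Any[]; singleton⁻)
open import Data.List.Membership.Propositional using (_∈_)
open import Data.List.Membership.Propositional.Properties using (∈-cartesianProduct⁺)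
import Data.List.Membership.DecPropositional as DecMembership
open import Data.Vec using (Vec; []; _∷_; zipWith)
open import Function using (_∘_; id; _⇔_; mk⇔; Equivalence)
open import Function.Properties.Equivalence using () renaming (trans to ⇔-trans; sym to ⇔-sym)
open import Relation.Nullary using (Dec; no; ¬_)
open import Relation.Nullary.Decidable using (True; toWitness; from-yes; map′; _×-dec_; _⊎-dec_; ¬?)
open import Relation.Binary.Definitions using (DecidableEquality)
open import Relation.Binary.PropositionalEquality

open Equivalence using (to; from)

-- Convergents as products of digit matrices

ℕ² : Set
ℕ² = ℕ × ℕ

drop : ℕ → CF → CF
drop k X i = X (k ℕ.+ i)

module Convergents where

  open import Data.Nat using (_+_; _*_; _≤_; _<_)
  open import Data.Nat.Tactic.RingSolver using (solve-∀)

  -- A State (p′ , q′ , p , q) is the matrix with columns (p′ , q′) and (p , q); step d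
  -- multiplies it on the right by the digit matrix with columns (0 , 1) and (1 , d), so
  -- conv X n is the product of the first n digit matrices and cvg X n its second column.
  _·_ : State → ℕ² → ℕ²
  (p′ , q′ , p , q) · (u , w) = p′ * u + p * w , q′ * u + q * w

  _⊙_ : State → State → State
  (a′ , c′ , a , c) ⊙ (p′ , q′ , p , q) =
    a′ * p′ + a * q′ , c′ * p′ + c * q′ , a′ * p + a * q , c′ * p + c * q

  column₂ : State → ℕ²
  column₂ (_ , _ , p , q) = p , q

  step-⊙ : ∀ d S T → step d (S ⊙ T) ≡ S ⊙ step d T
  step-⊙ d (a′ , c′ , a , c) (p′ , q′ , p , q) =
    cong₂ (λ u w → a′ * p + a * q , c′ * p + c * q , u , w)
          (distrib d a′ a p q p′ q′) (distrib d c′ c p q p′ q′)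
    where
    distrib : ∀ d s t p q p′ q′ →
              d * (s * p + t * q) + (s * p′ + t * q′) ≡ s * (d * p + p′) + t * (d * q + q′)
    distrib = solve-∀

  ⊙-identityʳ : ∀ S → S ⊙ (1 , 0 , 0 , 1) ≡ S
  ⊙-identityʳ (a′ , c′ , a , c) =
    cong₂ _,_ (first a′ a) (cong₂ _,_ (first c′ c) (cong₂ _,_ (second a′ a) (second c′ c)))
    where
    first : ∀ s t → s * 1 + t * 0 ≡ s
    first = solve-∀
    second : ∀ s t → s * 0 + t * 1 ≡ t
    second = solve-∀

  conv-+ : ∀ X k n → conv X (k + n) ≡ conv X k ⊙ conv (drop k X) n
  conv-+ X k zero rewrite ℕₚ.+-identityʳ k = sym (⊙-identityʳ (conv X k))
  conv-+ X k (suc n) rewrite ℕₚ.+-suc k n =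
    trans (cong (step (X (k + n))) (conv-+ X k n)) (step-⊙ (X (k + n)) (conv X k) (conv (drop k X) n))

  cvg-+ : ∀ X k n → cvg X (k + n) ≡ conv X k · cvg (drop k X) n
  cvg-+ X k n = cong column₂ (conv-+ X k n)

  lo-suc : ∀ X m → lo X (suc m) ≡ conv X 2 · lo (drop 2 X) m
  lo-suc X m = trans (cong (cvg X) (ℕₚ.*-suc 2 m)) (cvg-+ X 2 (2 * m))

  hi-suc : ∀ X m → hi X (suc m) ≡ conv X 2 · hi (drop 2 X) m
  hi-suc X m = trans (cong (cvg X ∘ suc) (ℕₚ.*-suc 2 m)) (cvg-+ X 2 (suc (2 * m)))

  hi-zero : ∀ X → hi X 0 ≡ (1 , X 0)
  hi-zero X = cong₂ _,_ (cong (_+ 1) (ℕₚ.*-zeroʳ (X 0)))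
                        (trans (ℕₚ.+-identityʳ _) (ℕₚ.*-identityʳ (X 0)))

  conv-cong : ∀ {X Y} → X ≗cf Y → ∀ n → conv X n ≡ conv Y n
  conv-cong e zero    = refl
  conv-cong e (suc n) = cong₂ step (e n) (conv-cong e n)

  lo-cong : ∀ {X Y} → X ≗cf Y → ∀ m → lo X m ≡ lo Y m
  lo-cong e m = cong column₂ (conv-cong e (2 * m))

  hi-cong : ∀ {X Y} → X ≗cf Y → ∀ m → hi X m ≡ hi Y m
  hi-cong e m = cong column₂ (conv-cong e (suc (2 * m)))

  -- the determinant of conv X n is (-1)ⁿ
  EvenDet : State → Set
  EvenDet (p′ , q′ , p , q) = p′ * q ≡ suc (p * q′)

  step²-EvenDet : ∀ d e S → EvenDet S → EvenDet (step e (step d S))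
  step²-EvenDet d e (p′ , q′ , p , q) h = begin
    (d * p + p′) * (e * (d * q + q′) + q)                         ≡⟨ expand d e p′ q′ p q ⟩
    e * (d * p + p′) * (d * q + q′) + (d * p * q + p′ * q)
      ≡⟨ cong (λ t → e * (d * p + p′) * (d * q + q′) + (d * p * q + t)) h ⟩
    e * (d * p + p′) * (d * q + q′) + (d * p * q + suc (p * q′))  ≡⟨ collect d e p′ q′ p q ⟩
    suc ((e * (d * p + p′) + p) * (d * q + q′))                   ∎
    where
    open ≡-Reasoning
    expand : ∀ d e p′ q′ p q → (d * p + p′) * (e * (d * q + q′) + q)
                                ≡ e * (d * p + p′) * (d * q + q′) + (d * p * q + p′ * q)
    expand = solve-∀
    collect : ∀ d e p′ q′ p q → e * (d * p + p′) * (d * q + q′) + (d * p * q + suc (p * q′))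
                                 ≡ suc ((e * (d * p + p′) + p) * (d * q + q′))
    collect = solve-∀

  conv-EvenDet : ∀ X m → EvenDet (conv X (2 * m))
  conv-EvenDet X zero    = refl
  conv-EvenDet X (suc m) =
    subst (EvenDet ∘ conv X) (sym (ℕₚ.*-suc 2 m))
          (step²-EvenDet (X (2 * m)) (X (suc (2 * m))) (conv X (2 * m)) (conv-EvenDet X m))

  lo<hi : ∀ X m → frac< (lo X m) (hi X m)
  lo<hi X m = below-step (X (2 * m)) (conv X (2 * m)) (conv-EvenDet X m)
    where
    below-step : ∀ d S → EvenDet S → frac< (column₂ S) (column₂ (step d S))
    below-step d (p′ , q′ , p , q) h = begin-strict
      p * (d * q + q′)          ≡⟨ left d p q q′ ⟩
      d * p * q + p * q′        <⟨ ℕₚ.+-monoʳ-< (d * p * q) (ℕₚ.n<1+n (p * q′)) ⟩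
      d * p * q + suc (p * q′)  ≡⟨ cong (λ t → d * p * q + t) (sym h) ⟩
      d * p * q + p′ * q        ≡⟨ right d p q p′ ⟩
      (d * p + p′) * q          ∎
      where
      open ℕₚ.≤-Reasoning
      left : ∀ d p q q′ → p * (d * q + q′) ≡ d * p * q + p * q′
      left = solve-∀
      right : ∀ d p q p′ → d * p * q + p′ * q ≡ (d * p + p′) * q
      right = solve-∀

  denominators-positive : ∀ {X} → (∀ i → 1 ≤ X i) → ∀ n →
                          1 ≤ proj₂ (cvg X n) × 1 ≤ proj₂ (cvg X (suc n))
  denominators-positive pos zero =
    s≤s z≤n , subst (1 ≤_) (sym (trans (ℕₚ.+-identityʳ _) (ℕₚ.*-identityʳ _))) (pos 0)
  denominators-positive pos (suc n) =
    let qₙ , qₙ₊₁ = denominators-positive pos n in qₙ₊₁ , ℕₚ.≤-trans qₙ (ℕₚ.m≤n+m _ _)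

  denominator-positive : ∀ {X} → (∀ i → 1 ≤ X i) → ∀ n → 1 ≤ proj₂ (cvg X n)
  denominator-positive pos n = proj₁ (denominators-positive pos n)

  pairMat : ℕ → ℕ → State
  pairMat d e = step e (step d (1 , 0 , 0 , 1))

  pairMat-explicit : ∀ d e → pairMat d e ≡ (1 , d , e , e * d + 1)
  pairMat-explicit d e
    rewrite ℕₚ.*-zeroʳ d | ℕₚ.*-identityʳ d | ℕₚ.+-identityʳ d
          | ℕₚ.*-identityʳ e | ℕₚ.+-identityʳ e = refl

  -- every continued fraction [3, k, …] lies below every [2, k, …]
  pairMat-3-below-2 : ∀ k r s u w → 1 ≤ k → 1 ≤ s → 1 ≤ w →
                      frac< (pairMat 3 k · (r , s)) (pairMat 2 k · (u , w))
  pairMat-3-below-2 (suc j) r (suc s) u (suc w) _ _ _ =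
    subst₂ (λ A B → frac< (A · (r , suc s)) (B · (u , suc w)))
           (sym (pairMat-explicit 3 (suc j))) (sym (pairMat-explicit 2 (suc j)))
           (<-by-slack _ (slack j r s u w))
    where
    <-by-slack : ∀ {m n} k → n ≡ suc (m + k) → m < n
    <-by-slack k refl = s≤s (ℕₚ.m≤m+n _ k)
    slack : ∀ j r s u w →
      (1 * u + suc j * suc w) * (3 * r + (suc j * 3 + 1) * suc s)
      ≡ suc ((1 * r + suc j * suc s) * (2 * u + (suc j * 2 + 1) * suc w)
             + (r * u + (2 + j) * suc s * u + j * r * suc w
                + (j * j + 2 * j) * suc s * suc w + s * w + s + w))
    slack = solve-∀

  Leq-from-leading : ∀ {X Y} → frac< (lo X 0) (hi Y 0) →
    (∀ r s u w → 1 ≤ s → 1 ≤ w → frac< (conv X 2 · (r , s)) (conv Y 2 · (u , w))) →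
    (∀ i → 1 ≤ X (2 + i)) → (∀ i → 1 ≤ Y (2 + i)) → Leq X Y
  Leq-from-leading base separated posX posY zero = base
  Leq-from-leading {X} {Y} base separated posX posY (suc m) =
    subst₂ frac< (sym (lo-suc X m)) (sym (hi-suc Y m))
      (separated _ _ _ _ (denominator-positive posX (2 * m)) (denominator-positive posY (suc (2 * m))))

open Convergents
open import Data.Integer using (_+_; _*_; _-_; -_; _<_; _≤_; _<?_)
open ≡-Reasoning
open import Data.Integer.Tactic.RingSolver using (solve-∀)

-- Multilinear forms

Form : ℕ → Set
Form zero    = ℤ
Form (suc n) = Form n × Form n

⟦_⟧ : ∀ {n} → Form n → Vec ℕ² n → ℤ
⟦_⟧ {zero}  c         []             = c
⟦_⟧ {suc n} (f₀ , f₁) ((p , q) ∷ vs) = + p * ⟦ f₀ ⟧ vs + + q * ⟦ f₁ ⟧ vs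

combine : ∀ {n} → ℤ → Form n → ℤ → Form n → Form n
combine {zero}  a f         b g         = a * f + b * g
combine {suc n} a (f₀ , f₁) b (g₀ , g₁) = combine a f₀ b g₀ , combine a f₁ b g₁

scale : ∀ {n} → ℤ → Form n → Form n
scale {zero}  a f         = a * f
scale {suc n} a (f₀ , f₁) = scale a f₀ , scale a f₁

⟦combine⟧ : ∀ {n} a (F : Form n) b G vs → ⟦ combine a F b G ⟧ vs ≡ a * ⟦ F ⟧ vs + b * ⟦ G ⟧ vs
⟦combine⟧ {zero}  a f         b g         []             = refl
⟦combine⟧ {suc n} a (f₀ , f₁) b (g₀ , g₁) ((p , q) ∷ vs) = begin
  + p * ⟦ combine a f₀ b g₀ ⟧ vs + + q * ⟦ combine a f₁ b g₁ ⟧ vs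
    ≡⟨ cong₂ (λ s t → + p * s + + q * t) (⟦combine⟧ a f₀ b g₀ vs) (⟦combine⟧ a f₁ b g₁ vs) ⟩
  + p * (a * ⟦ f₀ ⟧ vs + b * ⟦ g₀ ⟧ vs) + + q * (a * ⟦ f₁ ⟧ vs + b * ⟦ g₁ ⟧ vs)
    ≡⟨ regroup (+ p) (+ q) a b _ _ _ _ ⟩
  a * (+ p * ⟦ f₀ ⟧ vs + + q * ⟦ f₁ ⟧ vs) + b * (+ p * ⟦ g₀ ⟧ vs + + q * ⟦ g₁ ⟧ vs) ∎
  where
  regroup : ∀ p q a b f₀ g₀ f₁ g₁ →
            p * (a * f₀ + b * g₀) + q * (a * f₁ + b * g₁) ≡ a * (p * f₀ + q * f₁) + b * (p * g₀ + q * g₁)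
  regroup = solve-∀

⟦scale⟧ : ∀ {n} a (F : Form n) vs → ⟦ scale a F ⟧ vs ≡ a * ⟦ F ⟧ vs
⟦scale⟧ {zero}  a f         []             = refl
⟦scale⟧ {suc n} a (f₀ , f₁) ((p , q) ∷ vs) = begin
  + p * ⟦ scale a f₀ ⟧ vs + + q * ⟦ scale a f₁ ⟧ vs
    ≡⟨ cong₂ (λ s t → + p * s + + q * t) (⟦scale⟧ a f₀ vs) (⟦scale⟧ a f₁ vs) ⟩
  + p * (a * ⟦ f₀ ⟧ vs) + + q * (a * ⟦ f₁ ⟧ vs)
    ≡⟨ regroup (+ p) (+ q) a _ _ ⟩
  a * (+ p * ⟦ f₀ ⟧ vs + + q * ⟦ f₁ ⟧ vs) ∎
  where
  regroup : ∀ p q a f₀ f₁ → p * (a * f₀) + q * (a * f₁) ≡ a * (p * f₀ + q * f₁)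
  regroup = solve-∀

pos-linear : ∀ a b c d → + (a ℕ.* b ℕ.+ c ℕ.* d) ≡ + a * + b + + c * + d
pos-linear a b c d = trans (ℤₚ.pos-+ (a ℕ.* b) (c ℕ.* d)) (cong₂ _+_ (ℤₚ.pos-* a b) (ℤₚ.pos-* c d))

pos-affine : ∀ a b c → + (a ℕ.+ b ℕ.* c) ≡ + a + + b * + c
pos-affine a b c = trans (ℤₚ.pos-+ a (b ℕ.* c)) (cong (_+_ (+ a)) (ℤₚ.pos-* b c))

pullbackFirst : ∀ {n} → State → Form (suc n) → Form (suc n)
pullbackFirst (p′ , q′ , p , q) (f₀ , f₁) = combine (+ p′) f₀ (+ q′) f₁ , combine (+ p) f₀ (+ q) f₁

pullback : ∀ {n} → Vec State n → Form n → Form n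
pullback {zero}  []       c         = c
pullback {suc n} (M ∷ Ms) (f₀ , f₁) = pullbackFirst M (pullback Ms f₀ , pullback Ms f₁)

⟦pullbackFirst⟧ : ∀ {n} M (F : Form (suc n)) v vs → ⟦ pullbackFirst M F ⟧ (v ∷ vs) ≡ ⟦ F ⟧ (M · v ∷ vs)
⟦pullbackFirst⟧ (p′ , q′ , p , q) (f₀ , f₁) (u , w) vs = begin
  + u * ⟦ combine (+ p′) f₀ (+ q′) f₁ ⟧ vs + + w * ⟦ combine (+ p) f₀ (+ q) f₁ ⟧ vs
    ≡⟨ cong₂ (λ s t → + u * s + + w * t) (⟦combine⟧ (+ p′) f₀ (+ q′) f₁ vs) (⟦combine⟧ (+ p) f₀ (+ q) f₁ vs) ⟩
  + u * (+ p′ * ⟦ f₀ ⟧ vs + + q′ * ⟦ f₁ ⟧ vs) + + w * (+ p * ⟦ f₀ ⟧ vs + + q * ⟦ f₁ ⟧ vs)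
    ≡⟨ regroup (+ u) (+ w) (+ p′) (+ q′) (+ p) (+ q) _ _ ⟩
  (+ p′ * + u + + p * + w) * ⟦ f₀ ⟧ vs + (+ q′ * + u + + q * + w) * ⟦ f₁ ⟧ vs
    ≡⟨ sym (cong₂ (λ s t → s * ⟦ f₀ ⟧ vs + t * ⟦ f₁ ⟧ vs) (pos-linear p′ u p w) (pos-linear q′ u q w)) ⟩
  ⟦ f₀ , f₁ ⟧ ((p′ , q′ , p , q) · (u , w) ∷ vs) ∎
  where
  regroup : ∀ u w p′ q′ p q f₀ f₁ → u * (p′ * f₀ + q′ * f₁) + w * (p * f₀ + q * f₁)
                                    ≡ (p′ * u + p * w) * f₀ + (q′ * u + q * w) * f₁
  regroup = solve-∀

⟦pullback⟧ : ∀ {n} Ms (F : Form n) vs → ⟦ pullback Ms F ⟧ vs ≡ ⟦ F ⟧ (zipWith _·_ Ms vs)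
⟦pullback⟧ {zero}  []       c         []       = refl
⟦pullback⟧ {suc n} (M ∷ Ms) (f₀ , f₁) (v ∷ vs) = begin
  ⟦ pullbackFirst M (pullback Ms f₀ , pullback Ms f₁) ⟧ (v ∷ vs)
    ≡⟨ ⟦pullbackFirst⟧ M (pullback Ms f₀ , pullback Ms f₁) v vs ⟩
  + proj₁ (M · v) * ⟦ pullback Ms f₀ ⟧ vs + + proj₂ (M · v) * ⟦ pullback Ms f₁ ⟧ vs
    ≡⟨ cong₂ (λ s t → + proj₁ (M · v) * s + + proj₂ (M · v) * t) (⟦pullback⟧ Ms f₀ vs) (⟦pullback⟧ Ms f₁ vs) ⟩
  ⟦ f₀ , f₁ ⟧ (zipWith _·_ (M ∷ Ms) (v ∷ vs)) ∎

combo : ℕ → ℕ → Form 3 → Form 3 → Vec ℕ² 3 → ℤ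
combo a b G₁ G₂ vs = + a * ⟦ G₁ ⟧ vs + + b * ⟦ G₂ ⟧ vs

combo-pullback : ∀ a b Ms G₁ G₂ vs →
                 combo a b (pullback Ms G₁) (pullback Ms G₂) vs ≡ combo a b G₁ G₂ (zipWith _·_ Ms vs)
combo-pullback a b Ms G₁ G₂ vs =
  cong₂ (λ s t → + a * s + + b * t) (⟦pullback⟧ Ms G₁ vs) (⟦pullback⟧ Ms G₂ vs)

combo-1-0 : ∀ G₁ G₂ vs → combo 1 0 G₁ G₂ vs ≡ ⟦ G₁ ⟧ vs
combo-1-0 G₁ G₂ vs = drop-zero (⟦ G₁ ⟧ vs) (⟦ G₂ ⟧ vs)
  where
  drop-zero : ∀ g h → + 1 * g + + 0 * h ≡ g
  drop-zero = solve-∀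

*-nonneg : ∀ a {i} → 0ℤ ≤ i → 0ℤ ≤ + a * i
*-nonneg a {i} h = subst (_≤ + a * i) (ℤₚ.*-zeroʳ (+ a)) (ℤₚ.*-monoˡ-≤-nonNeg (+ a) h)

*-nonpos : ∀ a {i} → i ≤ 0ℤ → + a * i ≤ 0ℤ
*-nonpos a {i} h = subst (+ a * i ≤_) (ℤₚ.*-zeroʳ (+ a)) (ℤₚ.*-monoˡ-≤-nonNeg (+ a) h)

*-neg : ∀ a {i} → i < 0ℤ → + suc a * i < 0ℤ
*-neg a {i} h = subst (+ suc a * i <_) (ℤₚ.*-zeroʳ (+ suc a)) (ℤₚ.*-monoˡ-<-pos (+ suc a) h)

*-pos : ∀ a {i} → 0ℤ < i → 0ℤ < + suc a * i
*-pos a {i} h = subst (_< + suc a * i) (ℤₚ.*-zeroʳ (+ suc a)) (ℤₚ.*-monoˡ-<-pos (+ suc a) h)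

*-neg⁻¹ : ∀ a {i} → + suc a * i < 0ℤ → i < 0ℤ
*-neg⁻¹ a {i} h = ℤₚ.*-cancelˡ-<-nonNeg (+ suc a) (subst (+ suc a * i <_) (sym (ℤₚ.*-zeroʳ (+ suc a))) h)

*-pos⁻¹ : ∀ a {i} → 0ℤ < + suc a * i → 0ℤ < i
*-pos⁻¹ a {i} h = ℤₚ.*-cancelˡ-<-nonNeg (+ suc a) (subst (_< + suc a * i) (sym (ℤₚ.*-zeroʳ (+ suc a))) h)

combo-nonneg : ∀ a b {G₁ G₂} vs → 0ℤ ≤ ⟦ G₁ ⟧ vs → 0ℤ ≤ ⟦ G₂ ⟧ vs → 0ℤ ≤ combo a b G₁ G₂ vs
combo-nonneg a b vs h₁ h₂ = ℤₚ.+-mono-≤ (*-nonneg a h₁) (*-nonneg b h₂)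

combo-nonpos : ∀ a b {G₁ G₂} vs → ⟦ G₁ ⟧ vs ≤ 0ℤ → ⟦ G₂ ⟧ vs ≤ 0ℤ → combo a b G₁ G₂ vs ≤ 0ℤ
combo-nonpos a b vs h₁ h₂ = ℤₚ.+-mono-≤ (*-nonpos a h₁) (*-nonpos b h₂)

combo-neg : ∀ a b {G₁ G₂} vs → 1 ℕ.≤ a → ⟦ G₁ ⟧ vs < 0ℤ → ⟦ G₂ ⟧ vs < 0ℤ → combo a b G₁ G₂ vs < 0ℤ
combo-neg (suc a) b vs _ h₁ h₂ = ℤₚ.+-mono-<-≤ (*-neg a h₁) (*-nonpos b (ℤₚ.<⇒≤ h₂))

combo-pos : ∀ a b {G₁ G₂} vs → 1 ℕ.≤ a → 0ℤ < ⟦ G₁ ⟧ vs → 0ℤ < ⟦ G₂ ⟧ vs → 0ℤ < combo a b G₁ G₂ vs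
combo-pos (suc a) b vs _ h₁ h₂ = ℤₚ.+-mono-<-≤ (*-pos a h₁) (*-nonneg b (ℤₚ.<⇒≤ h₂))

-- Bracketing by convergent boxes

Column : Set
Column = ℕ × ℕ × ℕ

column : CF → CF → CF → ℕ → Column
column X Y Z i = X i , Y i , Z i

column-≗ : ∀ {X Y Z X′ Y′ Z′} → X ≗cf X′ → Y ≗cf Y′ → Z ≗cf Z′ → ∀ i → column X Y Z i ≡ column X′ Y′ Z′ i
column-≗ ex ey ez i = cong₂ _,_ (ex i) (cong₂ _,_ (ey i) (ez i))

column-≗⁻ : ∀ {X Y Z X′ Y′ Z′} → (∀ i → column X Y Z i ≡ column X′ Y′ Z′ i) →
            X ≗cf X′ × Y ≗cf Y′ × Z ≗cf Z′
column-≗⁻ e = (λ i → proj₁ (,-injective (e i))) ,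
              (λ i → proj₁ (,-injective (proj₂ (,-injective (e i))))) ,
              (λ i → proj₂ (,-injective (proj₂ (,-injective (e i)))))

Block : Set
Block = Column × Column

leadingBlock : CF → CF → CF → Block
leadingBlock X Y Z = column X Y Z 0 , column X Y Z 1

blockMats : Block → Vec State 3
blockMats ((d₀ , e₀ , f₀) , (d₁ , e₁ , f₁)) = pairMat d₀ d₁ ∷ pairMat e₀ e₁ ∷ pairMat f₀ f₁ ∷ []

act : Block → Vec ℕ² 3 → Vec ℕ² 3
act c = zipWith _·_ (blockMats c)

pullbackBlock : Block → Form 3 → Form 3
pullbackBlock c = pullback (blockMats c)

lowerCorner upperCorner : CF → CF → CF → ℕ → Vec ℕ² 3
lowerCorner X Y Z m = lo X m ∷ lo Y m ∷ hi Z m ∷ []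
upperCorner X Y Z m = hi X m ∷ hi Y m ∷ lo Z m ∷ []

record BracketedAt (φ : Vec ℕ² 3 → ℤ) (X Y Z : CF) (m : ℕ) : Set where
  constructor _,_
  field
    below : φ (lowerCorner X Y Z m) < 0ℤ
    above : 0ℤ < φ (upperCorner X Y Z m)

Bracketed : (Vec ℕ² 3 → ℤ) → CF → CF → CF → Set
Bracketed φ X Y Z = ∀ m → BracketedAt φ X Y Z m

bracketedAt? : ∀ φ X Y Z m → Dec (BracketedAt φ X Y Z m)
bracketedAt? φ X Y Z m = map′ (λ (l , u) → l , u) (λ (l , u) → l , u)
                              ((φ (lowerCorner X Y Z m) <? 0ℤ) ×-dec (0ℤ <? φ (upperCorner X Y Z m)))

lowerCorner-suc : ∀ X Y Z m → lowerCorner X Y Z (suc m)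
                  ≡ act (leadingBlock X Y Z) (lowerCorner (drop 2 X) (drop 2 Y) (drop 2 Z) m)
lowerCorner-suc X Y Z m = cong₂ _∷_ (lo-suc X m) (cong₂ _∷_ (lo-suc Y m) (cong (_∷ []) (hi-suc Z m)))

upperCorner-suc : ∀ X Y Z m → upperCorner X Y Z (suc m)
                  ≡ act (leadingBlock X Y Z) (upperCorner (drop 2 X) (drop 2 Y) (drop 2 Z) m)
upperCorner-suc X Y Z m = cong₂ _∷_ (hi-suc X m) (cong₂ _∷_ (hi-suc Y m) (cong (_∷ []) (lo-suc Z m)))

BracketedAt-corners : ∀ {φ ψ X Y Z X′ Y′ Z′ m m′} →
  φ (lowerCorner X Y Z m) ≡ ψ (lowerCorner X′ Y′ Z′ m′) → φ (upperCorner X Y Z m) ≡ ψ (upperCorner X′ Y′ Z′ m′) →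
  BracketedAt φ X Y Z m ⇔ BracketedAt ψ X′ Y′ Z′ m′
BracketedAt-corners l≡ u≡ = mk⇔ (λ (l , u) → subst (_< 0ℤ) l≡ l , subst (0ℤ <_) u≡ u)
                               (λ (l , u) → subst (_< 0ℤ) (sym l≡) l , subst (0ℤ <_) (sym u≡) u)

BracketedAt-suc : ∀ {φ X Y Z m c} → leadingBlock X Y Z ≡ c →
  BracketedAt φ X Y Z (suc m) ⇔ BracketedAt (φ ∘ act c) (drop 2 X) (drop 2 Y) (drop 2 Z) m
BracketedAt-suc {φ} {X} {Y} {Z} {m} refl =
  BracketedAt-corners (cong φ (lowerCorner-suc X Y Z m)) (cong φ (upperCorner-suc X Y Z m))

BracketedAt-resp : ∀ {φ ψ X Y Z m} → (∀ vs → φ vs ≡ ψ vs) → BracketedAt φ X Y Z m ⇔ BracketedAt ψ X Y Z m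
BracketedAt-resp e = BracketedAt-corners (e _) (e _)

BracketedAt-scale : ∀ k {φ X Y Z m} → BracketedAt φ X Y Z m ⇔ BracketedAt (λ vs → + suc k * φ vs) X Y Z m
BracketedAt-scale k = mk⇔ (λ (l , u) → *-neg k l , *-pos k u) (λ (l , u) → *-neg⁻¹ k l , *-pos⁻¹ k u)

BracketedAt-≗ : ∀ {φ X Y Z X′ Y′ Z′} → X ≗cf X′ → Y ≗cf Y′ → Z ≗cf Z′ →
                ∀ m → BracketedAt φ X Y Z m → BracketedAt φ X′ Y′ Z′ m
BracketedAt-≗ {φ} {X} {Y} {Z} {X′} {Y′} {Z′} ex ey ez m = to (BracketedAt-corners (cong φ lower) (cong φ upper))
  where
  lower : lowerCorner X Y Z m ≡ lowerCorner X′ Y′ Z′ m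
  lower = cong₂ _∷_ (lo-cong ex m) (cong₂ _∷_ (lo-cong ey m) (cong (_∷ []) (hi-cong ez m)))
  upper : upperCorner X Y Z m ≡ upperCorner X′ Y′ Z′ m
  upper = cong₂ _∷_ (hi-cong ex m) (cong₂ _∷_ (hi-cong ey m) (cong (_∷ []) (lo-cong ez m)))

sumForm : Form 3
sumForm = ((+ 0 , + 0) , (+ 0 , + 1)) , ((+ 0 , + 1) , (-[1+ 0 ] , + 0))

⟦sumForm⟧ : ∀ a b c d e f → ⟦ sumForm ⟧ ((a , b) ∷ (c , d) ∷ (e , f) ∷ [])
            ≡ + ((a ℕ.* d ℕ.+ c ℕ.* b) ℕ.* f) - + (e ℕ.* (b ℕ.* d))
⟦sumForm⟧ a b c d e f = begin
  ⟦ sumForm ⟧ ((a , b) ∷ (c , d) ∷ (e , f) ∷ [])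
    ≡⟨ expand (+ a) (+ b) (+ c) (+ d) (+ e) (+ f) ⟩
  (+ a * + d + + c * + b) * + f - + e * (+ b * + d)
    ≡⟨ sym (cong₂ _-_ (trans (ℤₚ.pos-* (a ℕ.* d ℕ.+ c ℕ.* b) f) (cong (_* + f) (pos-linear a d c b)))
                      (trans (ℤₚ.pos-* e (b ℕ.* d)) (cong (+ e *_) (ℤₚ.pos-* b d)))) ⟩
  + ((a ℕ.* d ℕ.+ c ℕ.* b) ℕ.* f) - + (e ℕ.* (b ℕ.* d)) ∎
  where
  expand : ∀ a b c d e f →
    a * (c * (e * + 0 + f * + 0) + d * (e * + 0 + f * + 1))
      + b * (c * (e * + 0 + f * + 1) + d * (e * -[1+ 0 ] + f * + 0))
    ≡ (a * d + c * b) * f - e * (b * d)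
  expand = solve-∀

[i-j]+j≡i : ∀ i j → i - j + j ≡ i
[i-j]+j≡i = solve-∀

-<0⇔< : ∀ {i j} → i - j < 0ℤ ⇔ i < j
-<0⇔< {i} {j} = mk⇔ (λ h → subst₂ _<_ ([i-j]+j≡i i j) (ℤₚ.+-identityˡ j) (ℤₚ.+-monoˡ-< j h))
                     (λ h → subst (i - j <_) (ℤₚ.+-inverseʳ j) (ℤₚ.+-monoˡ-< (- j) h))

0<-⇔< : ∀ {i j} → 0ℤ < i - j ⇔ j < i
0<-⇔< {i} {j} = mk⇔ (λ h → subst₂ _<_ (ℤₚ.+-identityˡ j) ([i-j]+j≡i i j) (ℤₚ.+-monoˡ-< j h))
                     (λ h → subst (_< i - j) (ℤₚ.+-inverseʳ j) (ℤₚ.+-monoˡ-< (- j) h))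

sum<frac⇔ : ∀ u v w → sum<frac u v w ⇔ ⟦ sumForm ⟧ (u ∷ v ∷ w ∷ []) < 0ℤ
sum<frac⇔ (a , b) (c , d) (e , f) = mk⇔
  (λ h → subst (_< 0ℤ) (sym (⟦sumForm⟧ a b c d e f)) (from -<0⇔< (ℤ.+<+ h)))
  (λ h → ℤₚ.drop‿+<+ (to -<0⇔< (subst (_< 0ℤ) (⟦sumForm⟧ a b c d e f) h)))

frac<sum⇔ : ∀ u v w → frac<sum w u v ⇔ 0ℤ < ⟦ sumForm ⟧ (u ∷ v ∷ w ∷ [])
frac<sum⇔ (a , b) (c , d) (e , f) = mk⇔
  (λ h → subst (0ℤ <_) (sym (⟦sumForm⟧ a b c d e f)) (from 0<-⇔< (ℤ.+<+ h)))
  (λ h → ℤₚ.drop‿+<+ (to 0<-⇔< (subst (0ℤ <_) (⟦sumForm⟧ a b c d e f) h)))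

SumEq⇔Bracketed : ∀ {X Y Z} → SumEq X Y Z ⇔ Bracketed ⟦ sumForm ⟧ X Y Z
SumEq⇔Bracketed {X} {Y} {Z} = mk⇔
  (λ S m → to (sum<frac⇔ (lo X m) (lo Y m) (hi Z m)) (proj₁ (S m)) ,
           to (frac<sum⇔ (hi X m) (hi Y m) (lo Z m)) (proj₂ (S m)))
  (λ B m → from (sum<frac⇔ (lo X m) (lo Y m) (hi Z m)) (BracketedAt.below (B m)) ,
           from (frac<sum⇔ (hi X m) (hi Y m) (lo Z m)) (BracketedAt.above (B m)))

-- Finite search certificates

D₂ D₃ : List ℕ
D₂ = 1 ∷ 2 ∷ []
D₃ = 1 ∷ 2 ∷ 3 ∷ []

cube : List ℕ → List Column
cube ds = cartesianProduct ds (cartesianProduct ds ds)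

column∈cube : ∀ {X Y Z i ds} → X i ∈ ds → Y i ∈ ds → Z i ∈ ds → column X Y Z i ∈ cube ds
column∈cube x y z = ∈-cartesianProduct⁺ x (∈-cartesianProduct⁺ y z)

_∈ᵇ?_ : (c : Block) (cs : List Block) → Dec (c ∈ cs)
_∈ᵇ?_ = DecMembership._∈?_ (≡-dec _≟ᶜ_ _≟ᶜ_)
  where
  _≟ᶜ_ : DecidableEquality Column
  _≟ᶜ_ = ≡-dec ℕ._≟_ (≡-dec ℕ._≟_ ℕ._≟_)

lower₀ upper₀ : Column → Vec ℕ² 3
lower₀ (_ , _ , f) = (0 , 1) ∷ (0 , 1) ∷ (1 , f) ∷ []
upper₀ (d , e , _) = (1 , d) ∷ (1 , e) ∷ (0 , 1) ∷ []

lowerCorner-zero : ∀ X Y Z → lowerCorner X Y Z 0 ≡ lower₀ (column X Y Z 0)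
lowerCorner-zero X Y Z = cong (λ h → (0 , 1) ∷ (0 , 1) ∷ h ∷ []) (hi-zero Z)

upperCorner-zero : ∀ X Y Z → upperCorner X Y Z 0 ≡ upper₀ (column X Y Z 0)
upperCorner-zero X Y Z = cong₂ (λ h h′ → h ∷ h′ ∷ (0 , 1) ∷ []) (hi-zero X) (hi-zero Y)

-- Both generators have the wrong sign at level 0, hence so has every nonnegative combination.
Refuted₀ : Form 3 → Form 3 → Column → Set
Refuted₀ G₁ G₂ c = (0ℤ ≤ ⟦ G₁ ⟧ (lower₀ c) × 0ℤ ≤ ⟦ G₂ ⟧ (lower₀ c))
                 ⊎ (⟦ G₁ ⟧ (upper₀ c) ≤ 0ℤ × ⟦ G₂ ⟧ (upper₀ c) ≤ 0ℤ)

refuted₀? : ∀ G₁ G₂ c → Dec (Refuted₀ G₁ G₂ c)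
refuted₀? G₁ G₂ c = ((0ℤ ℤ.≤? ⟦ G₁ ⟧ (lower₀ c)) ×-dec (0ℤ ℤ.≤? ⟦ G₂ ⟧ (lower₀ c)))
             ⊎-dec ((⟦ G₁ ⟧ (upper₀ c) ℤ.≤? 0ℤ) ×-dec (⟦ G₂ ⟧ (upper₀ c) ℤ.≤? 0ℤ))

Refuted₀-sound : ∀ a b {G₁ G₂ X Y Z} → Refuted₀ G₁ G₂ (column X Y Z 0) →
                 ¬ BracketedAt (combo a b G₁ G₂) X Y Z 0
Refuted₀-sound a b {G₁} {G₂} {X} {Y} {Z} (inj₁ (h₁ , h₂)) (neg , _) =
  ℤₚ.<⇒≱ neg (subst (λ vs → 0ℤ ≤ combo a b G₁ G₂ vs) (sym (lowerCorner-zero X Y Z))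
                    (combo-nonneg a b {G₁} {G₂} (lower₀ (column X Y Z 0)) h₁ h₂))
Refuted₀-sound a b {G₁} {G₂} {X} {Y} {Z} (inj₂ (h₁ , h₂)) (_ , pos) =
  ℤₚ.<⇒≱ pos (subst (λ vs → combo a b G₁ G₂ vs ≤ 0ℤ) (sym (upperCorner-zero X Y Z))
                    (combo-nonpos a b {G₁} {G₂} (upper₀ (column X Y Z 0)) h₁ h₂))

Confines : ℕ → List ℕ → List Block → Form 3 → Form 3 → Set
Confines zero    ds allowed G₁ G₂ = ⊥
Confines (suc n) ds allowed G₁ G₂ =
  All (λ c₀ → Refuted₀ G₁ G₂ c₀
            ⊎ All (λ c₁ → (c₀ , c₁) ∈ allowed
                        ⊎ Confines n D₂ [] (pullbackBlock (c₀ , c₁) G₁) (pullbackBlock (c₀ , c₁) G₂))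
                  (cube D₂))
      (cube ds)

confines? : ∀ n ds allowed G₁ G₂ → Dec (Confines n ds allowed G₁ G₂)
confines? zero    ds allowed G₁ G₂ = no id
confines? (suc n) ds allowed G₁ G₂ =
  all? (λ c₀ → refuted₀? G₁ G₂ c₀
             ⊎-dec all? (λ c₁ → ((c₀ , c₁) ∈ᵇ? allowed)
                              ⊎-dec confines? n D₂ [] (pullbackBlock (c₀ , c₁) G₁) (pullbackBlock (c₀ , c₁) G₂))
                        (cube D₂))
       (cube ds)

Bracketed-drop₂ : ∀ a b {G₁ G₂ X Y Z} → Bracketed (combo a b G₁ G₂) X Y Z →
  Bracketed (combo a b (pullbackBlock (leadingBlock X Y Z) G₁) (pullbackBlock (leadingBlock X Y Z) G₂))
            (drop 2 X) (drop 2 Y) (drop 2 Z)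
Bracketed-drop₂ a b {G₁} {G₂} {X} {Y} {Z} br m =
  from (BracketedAt-resp {X = drop 2 X} {drop 2 Y} {drop 2 Z} {m}
                         (combo-pullback a b (blockMats (leadingBlock X Y Z)) G₁ G₂))
       (to (BracketedAt-suc {combo a b G₁ G₂} {X} {Y} {Z} {m} refl) (br (suc m)))

confines-sound : ∀ n {ds allowed G₁ G₂} → Confines n ds allowed G₁ G₂ →
  ∀ a b {X Y Z} → column X Y Z 0 ∈ cube ds → (∀ i → column X Y Z (suc i) ∈ cube D₂) →
  Bracketed (combo a b G₁ G₂) X Y Z → leadingBlock X Y Z ∈ allowed
confines-sound (suc n) {ds} {allowed} {G₁} {G₂} cert a b {X} {Y} {Z} lead tail br
  with All.lookup cert lead
... | inj₁ refuted = ⊥-elim (Refuted₀-sound a b {G₁} {G₂} {X} {Y} {Z} refuted (br 0))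
... | inj₂ continues with All.lookup continues (tail 0)
...   | inj₁ allowed = allowed
...   | inj₂ deeper  =
  ⊥-elim (¬Any[] (confines-sound n deeper a b {drop 2 X} {drop 2 Y} {drop 2 Z} (tail 1) (tail ∘ suc ∘ suc)
                                 (Bracketed-drop₂ a b {G₁} {G₂} {X} {Y} {Z} br)))

-- Invariant cones

partner : Block → ℕ → Form 3 → Form 3
partner c k G = combine (+ suc k) (pullbackBlock c G) -[1+ 0 ] G

record InvariantCone : Set where
  field
    period    : Block
    G₁        : Form 3
    k a₂ b₂   : ℕ
    invariant : scale (+ suc k) (pullbackBlock period (partner period k G₁))
                ≡ combine (+ a₂) G₁ (+ b₂) (partner period k G₁)

PurelyPeriodic : Block → CF → CF → CF → Set
PurelyPeriodic c P Q R = leadingBlock P Q R ≡ c × drop 2 P ≗cf P × drop 2 Q ≗cf Q × drop 2 R ≗cf R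

module _ (K : InvariantCone) where

  open InvariantCone K

  T : Form 3 → Form 3
  T = pullbackBlock period

  G₂ : Form 3
  G₂ = partner period k G₁

  T-G₁ : ∀ vs → + suc k * ⟦ T G₁ ⟧ vs ≡ ⟦ G₁ ⟧ vs + ⟦ G₂ ⟧ vs
  T-G₁ vs = begin
    + suc k * ⟦ T G₁ ⟧ vs
      ≡⟨ split (+ suc k) (⟦ T G₁ ⟧ vs) (⟦ G₁ ⟧ vs) ⟩
    ⟦ G₁ ⟧ vs + (+ suc k * ⟦ T G₁ ⟧ vs + -[1+ 0 ] * ⟦ G₁ ⟧ vs)
      ≡⟨ cong (_+_ (⟦ G₁ ⟧ vs)) (sym (⟦combine⟧ (+ suc k) (T G₁) -[1+ 0 ] G₁ vs)) ⟩
    ⟦ G₁ ⟧ vs + ⟦ G₂ ⟧ vs ∎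
    where
    split : ∀ c t g → c * t ≡ g + (c * t + -[1+ 0 ] * g)
    split = solve-∀

  T-G₂ : ∀ vs → + suc k * ⟦ T G₂ ⟧ vs ≡ + a₂ * ⟦ G₁ ⟧ vs + + b₂ * ⟦ G₂ ⟧ vs
  T-G₂ vs = begin
    + suc k * ⟦ T G₂ ⟧ vs              ≡⟨ sym (⟦scale⟧ (+ suc k) (T G₂) vs) ⟩
    ⟦ scale (+ suc k) (T G₂) ⟧ vs      ≡⟨ cong (λ F → ⟦ F ⟧ vs) invariant ⟩
    ⟦ combine (+ a₂) G₁ (+ b₂) G₂ ⟧ vs ≡⟨ ⟦combine⟧ (+ a₂) G₁ (+ b₂) G₂ vs ⟩
    + a₂ * ⟦ G₁ ⟧ vs + + b₂ * ⟦ G₂ ⟧ vs ∎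

  cone-step : ∀ a b vs →
    + suc k * combo a b (T G₁) (T G₂) vs ≡ combo (a ℕ.+ b ℕ.* a₂) (a ℕ.+ b ℕ.* b₂) G₁ G₂ vs
  cone-step a b vs = begin
    + suc k * (+ a * t₁ + + b * t₂)                   ≡⟨ distrib (+ suc k) (+ a) (+ b) t₁ t₂ ⟩
    + a * (+ suc k * t₁) + + b * (+ suc k * t₂)       ≡⟨ cong₂ (λ s t → + a * s + + b * t) (T-G₁ vs) (T-G₂ vs) ⟩
    + a * (g₁ + g₂) + + b * (+ a₂ * g₁ + + b₂ * g₂)   ≡⟨ collect (+ a) (+ b) (+ a₂) (+ b₂) g₁ g₂ ⟩
    (+ a + + b * + a₂) * g₁ + (+ a + + b * + b₂) * g₂
      ≡⟨ sym (cong₂ (λ s t → s * g₁ + t * g₂) (pos-affine a b a₂) (pos-affine a b b₂)) ⟩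
    combo (a ℕ.+ b ℕ.* a₂) (a ℕ.+ b ℕ.* b₂) G₁ G₂ vs ∎
    where
    t₁ t₂ g₁ g₂ : ℤ
    t₁ = ⟦ T G₁ ⟧ vs
    t₂ = ⟦ T G₂ ⟧ vs
    g₁ = ⟦ G₁ ⟧ vs
    g₂ = ⟦ G₂ ⟧ vs
    distrib : ∀ c a b t₁ t₂ → c * (a * t₁ + b * t₂) ≡ a * (c * t₁) + b * (c * t₂)
    distrib = solve-∀
    collect : ∀ a b a₂ b₂ g₁ g₂ →
              a * (g₁ + g₂) + b * (a₂ * g₁ + b₂ * g₂) ≡ (a + b * a₂) * g₁ + (a + b * b₂) * g₂
    collect = solve-∀

  BracketedAt-cone : ∀ {X Y Z m} a b → leadingBlock X Y Z ≡ period →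
    BracketedAt (combo a b G₁ G₂) X Y Z (suc m)
    ⇔ BracketedAt (combo (a ℕ.+ b ℕ.* a₂) (a ℕ.+ b ℕ.* b₂) G₁ G₂) (drop 2 X) (drop 2 Y) (drop 2 Z) m
  BracketedAt-cone {X} {Y} {Z} {m} a b e =
    ⇔-trans (BracketedAt-suc {combo a b G₁ G₂} {X} {Y} {Z} {m} e)
    (⇔-trans (⇔-sym (BracketedAt-resp {X = drop 2 X} {drop 2 Y} {drop 2 Z} {m}
                                         (combo-pullback a b (blockMats period) G₁ G₂)))
    (⇔-trans (BracketedAt-scale k {combo a b (T G₁) (T G₂)} {drop 2 X} {drop 2 Y} {drop 2 Z} {m})
             (BracketedAt-resp {X = drop 2 X} {drop 2 Y} {drop 2 Z} {m} (cone-step a b))))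

  leading-forced : ∀ {n} → Confines n D₂ (period ∷ []) G₁ G₂ → ∀ a b {X Y Z} →
    (∀ i → column X Y Z i ∈ cube D₂) → Bracketed (combo a b G₁ G₂) X Y Z → leadingBlock X Y Z ≡ period
  leading-forced {n} cert a b {X} {Y} {Z} digits br =
    singleton⁻ (confines-sound n {D₂} {period ∷ []} {G₁} {G₂} cert a b {X} {Y} {Z} (digits 0) (digits ∘ suc) br)

  cone-forces : ∀ {n} → Confines n D₂ (period ∷ []) G₁ G₂ → ∀ {P Q R} → PurelyPeriodic period P Q R →
    ∀ a b {X Y Z} → (∀ i → column X Y Z i ∈ cube D₂) → Bracketed (combo a b G₁ G₂) X Y Z →
    ∀ i → column X Y Z i ≡ column P Q R i
  cone-forces cert (block , _) a b digits br zero =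
    proj₁ (,-injective (trans (leading-forced cert a b digits br) (sym block)))
  cone-forces cert (block , _) a b digits br (suc zero) =
    proj₂ (,-injective (trans (leading-forced cert a b digits br) (sym block)))
  cone-forces cert per@(_ , p , q , r) a b {X} {Y} {Z} digits br (suc (suc i)) =
    trans (cone-forces cert per (a ℕ.+ b ℕ.* a₂) (a ℕ.+ b ℕ.* b₂) (digits ∘ suc ∘ suc) tail-bracketed i)
          (sym (column-≗ p q r i))
    where
    tail-bracketed : Bracketed (combo (a ℕ.+ b ℕ.* a₂) (a ℕ.+ b ℕ.* b₂) G₁ G₂) (drop 2 X) (drop 2 Y) (drop 2 Z)
    tail-bracketed m = to (BracketedAt-cone a b (leading-forced cert a b digits br)) (br (suc m))

  cone-brackets : ∀ {P Q R} → PurelyPeriodic period P Q R →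
    BracketedAt ⟦ G₁ ⟧ P Q R 0 → BracketedAt ⟦ G₂ ⟧ P Q R 0 →
    ∀ m a b → 1 ℕ.≤ a → BracketedAt (combo a b G₁ G₂) P Q R m
  cone-brackets {P} {Q} {R} _ (neg₁ , pos₁) (neg₂ , pos₂) zero a b 1≤a =
    combo-neg a b {G₁} {G₂} (lowerCorner P Q R 0) 1≤a neg₁ neg₂ ,
    combo-pos a b {G₁} {G₂} (upperCorner P Q R 0) 1≤a pos₁ pos₂
  cone-brackets per@(block , p , q , r) signs₁ signs₂ (suc m) a b 1≤a =
    from (BracketedAt-cone a b block)
         (BracketedAt-≗ (sym ∘ p) (sym ∘ q) (sym ∘ r) m
           (cone-brackets per signs₁ signs₂ m (a ℕ.+ b ℕ.* a₂) (a ℕ.+ b ℕ.* b₂)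
                          (ℕₚ.≤-trans 1≤a (ℕₚ.m≤m+n a (b ℕ.* a₂)))))

  Certifies : CF → CF → CF → Set
  Certifies T₁ T₂ T₃ =
    G₁ ≡ pullbackBlock (leadingBlock T₁ T₂ T₃) sumForm ×
    PurelyPeriodic period (drop 2 T₁) (drop 2 T₂) (drop 2 T₃) ×
    Confines 4 D₂ (period ∷ []) G₁ G₂ ×
    BracketedAt ⟦ sumForm ⟧ T₁ T₂ T₃ 0 ×
    BracketedAt ⟦ G₁ ⟧ (drop 2 T₁) (drop 2 T₂) (drop 2 T₃) 0 ×
    BracketedAt ⟦ G₂ ⟧ (drop 2 T₁) (drop 2 T₂) (drop 2 T₃) 0

  certify : ∀ T₁ T₂ T₃ → G₁ ≡ pullbackBlock (leadingBlock T₁ T₂ T₃) sumForm →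
    PurelyPeriodic period (drop 2 T₁) (drop 2 T₂) (drop 2 T₃) →
    {_ : True (confines? 4 D₂ (period ∷ []) G₁ G₂)} →
    {_ : True (bracketedAt? ⟦ sumForm ⟧ T₁ T₂ T₃ 0)} →
    {_ : True (bracketedAt? ⟦ G₁ ⟧ (drop 2 T₁) (drop 2 T₂) (drop 2 T₃) 0)} →
    {_ : True (bracketedAt? ⟦ G₂ ⟧ (drop 2 T₁) (drop 2 T₂) (drop 2 T₃) 0)} →
    Certifies T₁ T₂ T₃
  certify T₁ T₂ T₃ entry periodic {c} {s} {s₁} {s₂} =
    entry , periodic ,
    toWitness {a? = confines? 4 D₂ (period ∷ []) G₁ G₂} c ,
    toWitness {a? = bracketedAt? ⟦ sumForm ⟧ T₁ T₂ T₃ 0} s ,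
    toWitness {a? = bracketedAt? ⟦ G₁ ⟧ (drop 2 T₁) (drop 2 T₂) (drop 2 T₃) 0} s₁ ,
    toWitness {a? = bracketedAt? ⟦ G₂ ⟧ (drop 2 T₁) (drop 2 T₂) (drop 2 T₃) 0} s₂

  entry-combo : ∀ c → G₁ ≡ pullbackBlock c sumForm → ∀ vs → combo 1 0 G₁ G₂ vs ≡ ⟦ sumForm ⟧ (act c vs)
  entry-combo c entry vs = begin
    combo 1 0 G₁ G₂ vs                        ≡⟨ combo-1-0 G₁ G₂ vs ⟩
    ⟦ G₁ ⟧ vs                                 ≡⟨ cong (λ F → ⟦ F ⟧ vs) entry ⟩
    ⟦ pullbackBlock c sumForm ⟧ vs            ≡⟨ ⟦pullback⟧ (blockMats c) sumForm vs ⟩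
    ⟦ sumForm ⟧ (act c vs)                    ∎

  certified-unique : ∀ {T₁ T₂ T₃} → Certifies T₁ T₂ T₃ →
    ∀ {x y z} → leadingBlock x y z ≡ leadingBlock T₁ T₂ T₃ →
    (∀ i → column x y z (suc i) ∈ cube D₂) → Bracketed ⟦ sumForm ⟧ x y z →
    x ≗cf T₁ × y ≗cf T₂ × z ≗cf T₃
  certified-unique {T₁} {T₂} {T₃} (entry , periodic , confined , _) {x} {y} {z} lead tail br =
    column-≗⁻ columns
    where
    tail-bracketed : Bracketed (combo 1 0 G₁ G₂) (drop 2 x) (drop 2 y) (drop 2 z)
    tail-bracketed m =
      from (BracketedAt-resp {X = drop 2 x} {drop 2 y} {drop 2 z} {m} (entry-combo (leadingBlock T₁ T₂ T₃) entry))
           (to (BracketedAt-suc {⟦ sumForm ⟧} {x} {y} {z} {m} lead) (br (suc m)))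
    columns : ∀ n → column x y z n ≡ column T₁ T₂ T₃ n
    columns zero          = proj₁ (,-injective lead)
    columns (suc zero)    = proj₂ (,-injective lead)
    columns (suc (suc n)) = cone-forces confined periodic 1 0 (tail ∘ suc) tail-bracketed n

  certified-brackets : ∀ {T₁ T₂ T₃} → Certifies T₁ T₂ T₃ → Bracketed ⟦ sumForm ⟧ T₁ T₂ T₃
  certified-brackets (_ , _ , _ , signs , _) zero = signs
  certified-brackets {T₁} {T₂} {T₃} (entry , periodic , _ , _ , signs₁ , signs₂) (suc m) =
    from (BracketedAt-suc {⟦ sumForm ⟧} {T₁} {T₂} {T₃} {m} refl)
         (to (BracketedAt-resp {X = drop 2 T₁} {drop 2 T₂} {drop 2 T₃} {m}
                               (entry-combo (leadingBlock T₁ T₂ T₃) entry))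
             (cone-brackets periodic signs₁ signs₂ m 1 0 (s≤s z≤n)))

-- The four solutions

1∈D₂ : 1 ∈ D₂
1∈D₂ = here refl

2∈D₂ : 2 ∈ D₂
2∈D₂ = there (here refl)

bounds⇒∈D₂ : ∀ {d} → 1 ℕ.≤ d → d ℕ.≤ 2 → d ∈ D₂
bounds⇒∈D₂ {suc zero}          _ _                 = 1∈D₂
bounds⇒∈D₂ {suc (suc zero)}    _ _                 = 2∈D₂
bounds⇒∈D₂ {suc (suc (suc _))} _ (s≤s (s≤s ()))

bounds⇒∈D₃ : ∀ {d} → 1 ℕ.≤ d → d ℕ.≤ 3 → d ∈ D₃
bounds⇒∈D₃ {suc zero}                _ _                       = here refl
bounds⇒∈D₃ {suc (suc zero)}          _ _                       = there (here refl)
bounds⇒∈D₃ {suc (suc (suc zero))}    _ _                       = there (there (here refl))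
bounds⇒∈D₃ {suc (suc (suc (suc _)))} _ (s≤s (s≤s (s≤s ())))

∈D₂⇒bounds : ∀ {d} → d ∈ D₂ → 1 ℕ.≤ d × d ℕ.≤ 2
∈D₂⇒bounds (here refl)         = s≤s z≤n , s≤s z≤n
∈D₂⇒bounds (there (here refl)) = s≤s z≤n , s≤s (s≤s z≤n)

∈D₃⇒bounds : ∀ {d} → d ∈ D₃ → 1 ℕ.≤ d × d ℕ.≤ 3
∈D₃⇒bounds (here refl)                 = s≤s z≤n , s≤s z≤n
∈D₃⇒bounds (there (here refl))         = s≤s z≤n , s≤s (s≤s z≤n)
∈D₃⇒bounds (there (there (here refl))) = s≤s z≤n , s≤s (s≤s (s≤s z≤n))

B21⇒digits : ∀ {x} → B21 x → x 0 ∈ D₃ × (∀ i → x (suc i) ∈ D₂)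
B21⇒digits (positive , first , rest) =
  bounds⇒∈D₃ (positive 0) first , λ i → bounds⇒∈D₂ (positive (suc i)) (rest i)

digits⇒B21 : ∀ {x} → x 0 ∈ D₃ → (∀ i → x (suc i) ∈ D₂) → B21 x
digits⇒B21 {x} first rest = positive , proj₂ (∈D₃⇒bounds first) , λ i → proj₂ (∈D₂⇒bounds (rest i))
  where
  positive : ∀ i → 1 ℕ.≤ x i
  positive zero    = proj₁ (∈D₃⇒bounds first)
  positive (suc i) = proj₁ (∈D₂⇒bounds (rest i))

B21-≗ : ∀ {x X} → x ≗cf X → B21 X → B21 x
B21-≗ {x} {X} e b =
  digits⇒B21 {x} (subst (_∈ D₃) (sym (e 0)) first) (λ i → subst (_∈ D₂) (sym (e (suc i))) (rest i))
  where
  first : X 0 ∈ D₃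
  first = proj₁ (B21⇒digits {X} b)
  rest : ∀ i → X (suc i) ∈ D₂
  rest = proj₂ (B21⇒digits {X} b)

leading-columns : ∀ {x y z} → B21 x → B21 y → B21 z → column x y z 0 ∈ cube D₃
leading-columns {x} {y} {z} bx by bz =
  column∈cube {x} {y} {z} (proj₁ (B21⇒digits {x} bx)) (proj₁ (B21⇒digits {y} by)) (proj₁ (B21⇒digits {z} bz))

tail-columns : ∀ {x y z} → B21 x → B21 y → B21 z → ∀ i → column x y z (suc i) ∈ cube D₂
tail-columns {x} {y} {z} bx by bz i =
  column∈cube {x} {y} {z} (proj₂ (B21⇒digits {x} bx) i) (proj₂ (B21⇒digits {y} by) i) (proj₂ (B21⇒digits {z} bz) i)

alt∈ : ∀ {u v ds} → u ∈ ds → v ∈ ds → ∀ i → alt u v i ∈ ds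
alt∈ u v zero    = u
alt∈ u v (suc i) = alt∈ v u i

B21-s3̅12 : B21 s3̅12
B21-s3̅12 = digits⇒B21 {s3̅12} (there (there (here refl))) (alt∈ 1∈D₂ 2∈D₂)

B21-s̅21 : B21 s̅21
B21-s̅21 = digits⇒B21 {s̅21} (there (here refl)) (alt∈ 1∈D₂ 2∈D₂)

B21-s111̅21 : B21 s111̅21
B21-s111̅21 = digits⇒B21 {s111̅21} (here refl) λ where
  zero          → 1∈D₂
  (suc zero)    → 1∈D₂
  (suc (suc i)) → alt∈ 2∈D₂ 1∈D₂ i

B21-s̅12 : B21 s̅12
B21-s̅12 = digits⇒B21 {s̅12} (here refl) (alt∈ 2∈D₂ 1∈D₂)

B21-s3̅2 : B21 s3̅2
B21-s3̅2 = digits⇒B21 {s3̅2} (there (there (here refl))) (λ _ → 2∈D₂)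

B21-s̅2 : B21 s̅2
B21-s̅2 = digits⇒B21 {s̅2} (there (here refl)) (λ _ → 2∈D₂)

B21-s11̅2 : B21 s11̅2
B21-s11̅2 = digits⇒B21 {s11̅2} (here refl) λ where
  zero    → 1∈D₂
  (suc _) → 2∈D₂

B21-s1̅2 : B21 s1̅2
B21-s1̅2 = digits⇒B21 {s1̅2} (here refl) (λ _ → 2∈D₂)

Leq-≗ : ∀ {x y X Y} → x ≗cf X → y ≗cf Y → Leq X Y → Leq x y
Leq-≗ ex ey X≤Y n = subst₂ frac< (sym (lo-cong ex n)) (sym (hi-cong ey n)) (X≤Y n)

Leq-s3̅12-s̅21 : Leq s3̅12 s̅21
Leq-s3̅12-s̅21 = Leq-from-leading {s3̅12} {s̅21} (s≤s z≤n) (λ r s u w → pairMat-3-below-2 1 r s u w (s≤s z≤n))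
                                 (proj₁ B21-s3̅12 ∘ (2 ℕ.+_)) (proj₁ B21-s̅21 ∘ (2 ℕ.+_))

Leq-s3̅2-s̅2 : Leq s3̅2 s̅2
Leq-s3̅2-s̅2 = Leq-from-leading {s3̅2} {s̅2} (s≤s z≤n) (λ r s u w → pairMat-3-below-2 2 r s u w (s≤s z≤n))
                               (proj₁ B21-s3̅2 ∘ (2 ℕ.+_)) (proj₁ B21-s̅2 ∘ (2 ℕ.+_))

cone₁ cone₂ cone₃ cone₄ : InvariantCone
cone₁ = record
  { period    = leadingBlock (drop 2 s3̅12) (drop 2 s̅21) (drop 2 s111̅21)
  ; G₁        = pullbackBlock (leadingBlock s3̅12 s̅21 s111̅21) sumForm
  ; k         = 2
  ; a₂        = 2
  ; b₂        = 11
  ; invariant = refl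
  }
cone₂ = record
  { period    = leadingBlock (drop 2 s̅21) (drop 2 s̅21) (drop 2 s̅12)
  ; G₁        = pullbackBlock (leadingBlock s̅21 s̅21 s̅12) sumForm
  ; k         = 2
  ; a₂        = 2
  ; b₂        = 11
  ; invariant = refl
  }
cone₃ = record
  { period    = leadingBlock (drop 2 s3̅2) (drop 2 s3̅2) (drop 2 s11̅2)
  ; G₁        = pullbackBlock (leadingBlock s3̅2 s3̅2 s11̅2) sumForm
  ; k         = 4
  ; a₂        = 4
  ; b₂        = 29
  ; invariant = refl
  }
cone₄ = record
  { period    = leadingBlock (drop 2 s3̅2) (drop 2 s̅2) (drop 2 s1̅2)
  ; G₁        = pullbackBlock (leadingBlock s3̅2 s̅2 s1̅2) sumForm
  ; k         = 4
  ; a₂        = 4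
  ; b₂        = 29
  ; invariant = refl
  }

certified₁ : Certifies cone₁ s3̅12 s̅21 s111̅21
certified₁ = certify cone₁ s3̅12 s̅21 s111̅21 refl (refl , (λ _ → refl) , (λ _ → refl) , λ where
  zero    → refl
  (suc _) → refl)

certified₂ : Certifies cone₂ s̅21 s̅21 s̅12
certified₂ = certify cone₂ s̅21 s̅21 s̅12 refl (refl , (λ _ → refl) , (λ _ → refl) , (λ _ → refl))

certified₃ : Certifies cone₃ s3̅2 s3̅2 s11̅2
certified₃ = certify cone₃ s3̅2 s3̅2 s11̅2 refl (refl , (λ _ → refl) , (λ _ → refl) , (λ _ → refl))

certified₄ : Certifies cone₄ s3̅2 s̅2 s1̅2
certified₄ = certify cone₄ s3̅2 s̅2 s1̅2 refl (refl , (λ _ → refl) , (λ _ → refl) , (λ _ → refl))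

survivors : List Block
survivors = leadingBlock s3̅12 s̅21 s111̅21 ∷ leadingBlock s̅21 s̅21 s̅12
          ∷ leadingBlock s3̅2 s3̅2 s11̅2 ∷ leadingBlock s3̅2 s̅2 s1̅2
          ∷ leadingBlock s̅21 s3̅12 s111̅21 ∷ leadingBlock s̅2 s3̅2 s1̅2 ∷ []

survivors-confined : Confines 4 D₃ survivors sumForm sumForm
survivors-confined = from-yes (confines? 4 D₃ survivors sumForm sumForm)

leading-survives : ∀ {x y z} → B21 x → B21 y → B21 z → Bracketed ⟦ sumForm ⟧ x y z →
                   leadingBlock x y z ∈ survivors
leading-survives {x} {y} {z} bx by bz br =
  confines-sound 4 {D₃} {survivors} {sumForm} {sumForm} survivors-confined 1 0 {x} {y} {z}
    (leading-columns bx by bz) (tail-columns bx by bz)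
    (λ m → from (BracketedAt-resp {X = x} {y} {z} {m} (combo-1-0 sumForm sumForm)) (br m))

-- Leq x y at level 1 compares [x 0, x 1] with [y 0, y 1, y 2].
LevelOneOrder : Block → ℕ → Set
LevelOneOrder ((d₀ , e₀ , _) , (d₁ , e₁ , _)) t =
  frac< (column₂ (pairMat d₀ d₁)) (column₂ (step t (pairMat e₀ e₁)))

levelOneOrder? : ∀ c t → Dec (LevelOneOrder c t)
levelOneOrder? ((d₀ , e₀ , _) , (d₁ , e₁ , _)) t =
  frac<? (column₂ (pairMat d₀ d₁)) (column₂ (step t (pairMat e₀ e₁)))
  where
  frac<? : ∀ u v → Dec (frac< u v)
  frac<? (a , b) (c , d) = a ℕ.* d ℕ.<? c ℕ.* b

Leq-excludes : ∀ {x y z} c → leadingBlock x y z ≡ c → All (¬_ ∘ LevelOneOrder c) D₂ → y 2 ∈ D₂ → ¬ Leq x y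
Leq-excludes _ refl unordered y₂ x≤y = All.lookup unordered y₂ (x≤y 1)

swapped₁-unordered : All (¬_ ∘ LevelOneOrder (leadingBlock s̅21 s3̅12 s111̅21)) D₂
swapped₁-unordered = from-yes (all? (¬? ∘ levelOneOrder? (leadingBlock s̅21 s3̅12 s111̅21)) D₂)

swapped₂-unordered : All (¬_ ∘ LevelOneOrder (leadingBlock s̅2 s3̅2 s1̅2)) D₂
swapped₂-unordered = from-yes (all? (¬? ∘ levelOneOrder? (leadingBlock s̅2 s3̅2 s1̅2)) D₂)

Solves : CF → CF → CF → Set
Solves x y z = B21 x × B21 y × B21 z × Leq x y × SumEq x y z

Solutions : CF → CF → CF → Set
Solutions x y z = ((x ≗cf s3̅12) × (y ≗cf s̅21) × (z ≗cf s111̅21))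
                ⊎ ((x ≗cf s̅21) × (y ≗cf s̅21) × (z ≗cf s̅12))
                ⊎ ((x ≗cf s3̅2) × (y ≗cf s3̅2) × (z ≗cf s11̅2))
                ⊎ ((x ≗cf s3̅2) × (y ≗cf s̅2) × (z ≗cf s1̅2))

Solves⇒Solutions : ∀ {x y z} → Solves x y z → Solutions x y z
Solves⇒Solutions {x} {y} {z} (bx , by , bz , x≤y , sum) = by-leading-block (leading-survives bx by bz br)
  where
  br : Bracketed ⟦ sumForm ⟧ x y z
  br = to SumEq⇔Bracketed sum
  tail : ∀ i → column x y z (suc i) ∈ cube D₂
  tail = tail-columns bx by bz
  y₂ : y 2 ∈ D₂
  y₂ = proj₂ (B21⇒digits {y} by) 1
  by-leading-block : leadingBlock x y z ∈ survivors → Solutions x y z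
  by-leading-block (here e) =
    inj₁ (certified-unique cone₁ certified₁ e tail br)
  by-leading-block (there (here e)) =
    inj₂ (inj₁ (certified-unique cone₂ certified₂ e tail br))
  by-leading-block (there (there (here e))) =
    inj₂ (inj₂ (inj₁ (certified-unique cone₃ certified₃ e tail br)))
  by-leading-block (there (there (there (here e)))) =
    inj₂ (inj₂ (inj₂ (certified-unique cone₄ certified₄ e tail br)))
  by-leading-block (there (there (there (there (here e))))) =
    ⊥-elim (Leq-excludes {x} {y} {z} _ e swapped₁-unordered y₂ x≤y)
  by-leading-block (there (there (there (there (there (here e)))))) =
    ⊥-elim (Leq-excludes {x} {y} {z} _ e swapped₂-unordered y₂ x≤y)

Solves-≗ : ∀ {x y z X Y Z} → x ≗cf X × y ≗cf Y × z ≗cf Z → Solves X Y Z → Solves x y z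
Solves-≗ {x} {y} {z} (ex , ey , ez) (bX , bY , bZ , X≤Y , sum) =
  B21-≗ {x} ex bX , B21-≗ {y} ey bY , B21-≗ {z} ez bZ , Leq-≗ ex ey X≤Y ,
  from SumEq⇔Bracketed (λ m → BracketedAt-≗ (sym ∘ ex) (sym ∘ ey) (sym ∘ ez) m (to SumEq⇔Bracketed sum m))

Solutions⇒Solves : ∀ {x y z} → Solutions x y z → Solves x y z
Solutions⇒Solves (inj₁ e)               = Solves-≗ e (B21-s3̅12 , B21-s̅21 , B21-s111̅21 , Leq-s3̅12-s̅21 ,
                                             from SumEq⇔Bracketed (certified-brackets cone₁ certified₁))
Solutions⇒Solves (inj₂ (inj₁ e))        = Solves-≗ e (B21-s̅21 , B21-s̅21 , B21-s̅12 , lo<hi s̅21 ,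
                                             from SumEq⇔Bracketed (certified-brackets cone₂ certified₂))
Solutions⇒Solves (inj₂ (inj₂ (inj₁ e))) = Solves-≗ e (B21-s3̅2 , B21-s3̅2 , B21-s11̅2 , lo<hi s3̅2 ,
                                             from SumEq⇔Bracketed (certified-brackets cone₃ certified₃))
Solutions⇒Solves (inj₂ (inj₂ (inj₂ e))) = Solves-≗ e (B21-s3̅2 , B21-s̅2 , B21-s1̅2 , Leq-s3̅2-s̅2 ,
                                             from SumEq⇔Bracketed (certified-brackets cone₄ certified₄))

theorem2p9 : (x y z : CF) →
  ((B21 x × B21 y × B21 z × Leq x y × SumEq x y z) →
    (((x ≗cf s3̅12) × (y ≗cf s̅21) × (z ≗cf s111̅21))
     ⊎ ((x ≗cf s̅21) × (y ≗cf s̅21) × (z ≗cf s̅12))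
     ⊎ ((x ≗cf s3̅2) × (y ≗cf s3̅2) × (z ≗cf s11̅2))
     ⊎ ((x ≗cf s3̅2) × (y ≗cf s̅2) × (z ≗cf s1̅2))))
  × ((((x ≗cf s3̅12) × (y ≗cf s̅21) × (z ≗cf s111̅21))
     ⊎ ((x ≗cf s̅21) × (y ≗cf s̅21) × (z ≗cf s̅12))
     ⊎ ((x ≗cf s3̅2) × (y ≗cf s3̅2) × (z ≗cf s11̅2))
     ⊎ ((x ≗cf s3̅2) × (y ≗cf s̅2) × (z ≗cf s1̅2)))
    → (B21 x × B21 y × B21 z × Leq x y × SumEq x y z))
theorem2p9 x y z = Solves⇒Solutions {x} {y} {z} , Solutions⇒Solves {x} {y} {z}
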